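{- Let $G$ be a position of \textsc{Yashima} game on a bipartite graph. Then (1) $G$ is equal to $\{m\mid n\}$ for some integers $m,n$; and (2) if $G$ is a different-color position, then $G$ is equal to an integer.
   Context: \textsc{Yashima} game: a position consists of a finite undirected bipartite (multi)graph together with two distinct vertices occupied by Left's token and Right's token. A player to move slides their own token along an edge incident to its current vertex to the adjacent vertex, provided that vertex is not occupied by the opponent's token, and then deletes the edge just traversed. A player with no legal move loses (normal play), and positions are identified with the corresponding short combinatorial games, with the usual equality of games. A position is a different-color position if there is a proper 2-coloring of its graph in which the vertices of the two tokens receive different colors. -}

module Defs where

open import Data.Nat using (ℕ; zero; suc)
open import Data.Bool using (Bool; true; false; not; _∧_; _∨_)
open import Data.List using (List; []; _∷_; _++_) renaming (map to mapL)
open import Data.Vec using (Vec; lookup; removeAt; allFin; toList)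
open import Data.Fin using (Fin; _≟_)
open import Data.Integer using (ℤ; +_; -[1+_])
open import Data.Product using (_×_; _,_; Σ; proj₁; proj₂)
open import Relation.Nullary using (¬_; yes; no)
open import Relation.Binary.PropositionalEquality using (_≡_; _≢_)

data Game : Set where
  ⟨_∣_⟩ : List Game → List Game → Game

-- G ≤ H  iff  no G^L with H ≤ G^L  and  no H^R with H^R ≤ G.
mutual
  leB : Game → Game → Bool
  leB ⟨ gl ∣ gr ⟩ ⟨ hl ∣ hr ⟩ =
    not (someAbove ⟨ hl ∣ hr ⟩ gl) ∧ not (someBelow hr ⟨ gl ∣ gr ⟩)

  someAbove : Game → List Game → Bool
  someAbove H []       = false
  someAbove H (x ∷ xs) = leB H x ∨ someAbove H xs

  someBelow : List Game → Game → Bool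
  someBelow []       G = false
  someBelow (x ∷ xs) G = leB x G ∨ someBelow xs G

_≤G_ : Game → Game → Set
G ≤G H = leB G H ≡ true

_≈G_ : Game → Game → Set
G ≈G H = (G ≤G H) × (H ≤G G)

natGame : ℕ → Game
natGame zero    = ⟨ [] ∣ [] ⟩
natGame (suc n) = ⟨ natGame n ∷ [] ∣ [] ⟩

negNatGame : ℕ → Game
negNatGame zero    = ⟨ [] ∣ [] ⟩
negNatGame (suc n) = ⟨ [] ∣ negNatGame n ∷ [] ⟩

intGame : ℤ → Game
intGame (+ n)     = natGame n
intGame -[1+ n ]  = negNatGame (suc n)

switchGame : ℤ → ℤ → Game
switchGame m n = ⟨ intGame m ∷ [] ∣ intGame n ∷ [] ⟩

-- Yashima positions.  A multigraph on vertex set Fin V with n edges is a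
-- vector of n (unordered) vertex pairs; parallel edges are allowed.

Edge : ℕ → Set
Edge V = Fin V × Fin V

-- Options of the token at vertex `me` (opponent's token at `opp`) using
-- edge i: slide along it to the other endpoint, provided that endpoint is
-- not occupied by the opponent; the resulting edge set deletes edge i.
private
  concatMapL : ∀ {A B : Set} → (A → List B) → List A → List B
  concatMapL f []       = []
  concatMapL f (x ∷ xs) = f x ++ concatMapL f xs

targets : ∀ {V} → Fin V → Fin V → Edge V → List (Fin V)
targets me opp (a , b) = side a b ++ side b a
  where
  side : _ → _ → List _
  side x y with x ≟ me | y ≟ opp
  ... | yes _ | no _  = y ∷ []
  ... | _     | _     = []

yashima : ∀ {V n} → Vec (Edge V) n → Fin V → Fin V → Game
yashima {V} {zero}  E l r = ⟨ [] ∣ [] ⟩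
yashima {V} {suc n} E l r = ⟨ lefts ∣ rights ⟩
  where
  lefts : List Game
  lefts = concatMapL
    (λ i → mapL (λ v → yashima (removeAt E i) v r)
                         (targets l r (lookup E i)))
    (toList (allFin (suc n)))
  rights : List Game
  rights = concatMapL
    (λ i → mapL (λ v → yashima (removeAt E i) l v)
                         (targets r l (lookup E i)))
    (toList (allFin (suc n)))

ProperColouring : ∀ {V n} → Vec (Edge V) n → (Fin V → Bool) → Set
ProperColouring {V} {n} E c = (i : Fin n) → c (proj₁ (lookup E i)) ≢ c (proj₂ (lookup E i))

Bipartite : ∀ {V n} → Vec (Edge V) n → Set
Bipartite {V} E = Σ (Fin V → Bool) (ProperColouring E)

DifferentColour : ∀ {V n} → Vec (Edge V) n → Fin V → Fin V → Set
DifferentColour {V} E l r =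
  Σ (Fin V → Bool) λ c → ProperColouring E c × c l ≢ c r

-- If the tokens have different colours, a left move l → v and a right move r → w give
-- c v = c r and c w = c l, so they use different edges and v ≠ w: the two moves commute,
-- and every left option L and right option R share the option Q reached by playing both.
-- Such a game is an integer as soon as every such Q is, because the integer
-- max_L min_{L^R} then fits strictly between its options.  The Q are again
-- different-colour positions, so induction on the number of edges gives (2).  In a
-- same-colour position every option is a different-colour position, hence an integer,
-- and a game with integer options is {max G^L | min G^R}; an integer n is {n-1 | n+1}.

module Submission where

open import Defs
open import Data.Fin using (Fin)
open import Data.Vec using (Vec)
open import Data.Integer using (ℤ)
open import Data.Product using (_×_; Σ)
open import Relation.Binary.PropositionalEquality using (_≢_)

open import Data.Bool using (Bool; true; false; not; _∧_)
import Data.Bool as Bool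
open import Data.Bool.Properties using (¬-not)
open import Data.Empty using (⊥; ⊥-elim)
open import Data.Fin using (_≟_; punchIn; punchOut) renaming (zero to fzero; suc to fsuc)
open import Data.Fin.Properties using (punchOut-punchIn; punchInᵢ≢i)
open import Data.Integer as ℤ using (+_; -[1+_]; +≤+; -≤-; -≤+)
open import Data.Integer.Properties using (suc-pred; ≤-totalPreorder)
open import Data.List using (List; []; _∷_; _++_; concatMap; map)
open import Data.List.Membership.Propositional using (_∈_; find; lose)
open import Data.List.Membership.Propositional.Properties using (∈-map⁻; ∈-map⁺; ∈-++⁺ʳ)
open import Data.List.Relation.Unary.All as All using (All; []; _∷_)
open import Data.List.Relation.Unary.All.Properties using (¬Any⇒All¬; All¬⇒¬Any)
open import Data.List.Relation.Unary.Any as Any using (Any; here; there)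
import Data.List.Relation.Unary.Any.Properties as Any
open import Data.Nat as ℕ using (ℕ; zero; suc; _+_; _<_; z≤n; s≤s)
open import Data.Nat.Induction using (<-wellFounded)
open import Data.Nat.Properties as ℕ using (m≤m+n; m≤n+m; n≤1+n; +-monoʳ-<; +-comm; +-assoc)
open import Data.Product using (∃; _,_; proj₁; proj₂; map₂; uncurry)
open import Data.Sum using (_⊎_; inj₁; inj₂; swap)
open import Data.Vec using (lookup; removeAt; allFin; toList; tabulate; _∷_)
open import Data.Vec.Membership.Propositional.Properties using (∈-toList⁺; ∈-allFin⁺)
open import Data.Vec.Properties using (removeAt-punchOut)
open import Function using (_∘_; _⇔_; mk⇔; Equivalence)
open import Induction.WellFounded using (Acc; acc)
open import Level using (0ℓ)
open import Relation.Binary.Bundles using (TotalPreorder)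
import Relation.Binary.Construct.Flip.EqAndOrd as Flip
open import Relation.Binary.PropositionalEquality using (_≡_; refl; sym; trans; cong; subst; module ≡-Reasoning)
open import Relation.Nullary using (¬_; yes; no; contradiction)

-- Order on games

leftOptions rightOptions : Game → List Game
leftOptions  ⟨ gl ∣ gr ⟩ = gl
rightOptions ⟨ gl ∣ gr ⟩ = gr

-- Unlike the Boolean leB, this record lets Agda infer both games from a proof's type.
record _≤_ (G H : Game) : Set where
  constructor mk≤
  field leB≡true : G ≤G H

open _≤_

_⧏_ : Game → Game → Set
G ⧏ H = ¬ H ≤ G

_≈_ : Game → Game → Set
G ≈ H = G ≤ H × H ≤ G

someAbove⇔ : ∀ H xs → someAbove H xs ≡ true ⇔ Any (H ≤_) xs
someAbove⇔ H []       = mk⇔ (λ ()) (λ ())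
someAbove⇔ H (x ∷ xs) with leB H x in H≤x
... | true  = mk⇔ (λ _ → here (mk≤ H≤x)) (λ _ → refl)
... | false = mk⇔ (there ∘ to) λ { (here (mk≤ H≤x′)) → contradiction (trans (sym H≤x) H≤x′) λ ()
                                   ; (there a) → from a }
  where open Equivalence (someAbove⇔ H xs)

someBelow⇔ : ∀ xs G → someBelow xs G ≡ true ⇔ Any (_≤ G) xs
someBelow⇔ []       G = mk⇔ (λ ()) (λ ())
someBelow⇔ (x ∷ xs) G with leB x G in x≤G
... | true  = mk⇔ (λ _ → here (mk≤ x≤G)) (λ _ → refl)
... | false = mk⇔ (there ∘ to) λ { (here (mk≤ x≤G′)) → contradiction (trans (sym x≤G) x≤G′) λ ()
                                   ; (there a) → from a }
  where open Equivalence (someBelow⇔ xs G)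

not∧not≡true⇔ : ∀ a b → not a ∧ not b ≡ true ⇔ (a ≢ true × b ≢ true)
not∧not≡true⇔ a b = mk⇔ to from
  where
  to : ∀ {a b} → not a ∧ not b ≡ true → a ≢ true × b ≢ true
  to {false} {false} _ = (λ ()) , (λ ())
  from : ∀ {a b} → a ≢ true × b ≢ true → not a ∧ not b ≡ true
  from {false} {false} _ = refl
  from {true}  (a≢true , _) = ⊥-elim (a≢true refl)
  from {false} {true} (_ , b≢true) = ⊥-elim (b≢true refl)

≤⇔ : ∀ {G H} → G ≤ H ⇔ (All (_⧏ H) (leftOptions G) × All (G ⧏_) (rightOptions H))
≤⇔ {G@(⟨ gl ∣ gr ⟩)} {H@(⟨ hl ∣ hr ⟩)} = mk⇔ to from
  where
  module A = Equivalence (someAbove⇔ H gl)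
  module B = Equivalence (someBelow⇔ hr G)
  module N = Equivalence (not∧not≡true⇔ (someAbove H gl) (someBelow hr G))
  to : G ≤ H → All (_⧏ H) gl × All (G ⧏_) hr
  to (mk≤ G≤H) = let (a , b) = N.to G≤H in ¬Any⇒All¬ gl (a ∘ A.from) , ¬Any⇒All¬ hr (b ∘ B.from)
  from : All (_⧏ H) gl × All (G ⧏_) hr → G ≤ H
  from (a , b) = mk≤ (N.from (All¬⇒¬Any a ∘ A.to , All¬⇒¬Any b ∘ B.to))

≤-intro : ∀ {G H} → All (_⧏ H) (leftOptions G) → All (G ⧏_) (rightOptions H) → G ≤ H
≤-intro a b = Equivalence.from ≤⇔ (a , b)

≤⇒leftOption⧏ : ∀ {G H x} → G ≤ H → x ∈ leftOptions G → x ⧏ H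
≤⇒leftOption⧏ G≤H = All.lookup (proj₁ (Equivalence.to ≤⇔ G≤H))

≤⇒⧏rightOption : ∀ {G H y} → G ≤ H → y ∈ rightOptions H → G ⧏ y
≤⇒⧏rightOption G≤H = All.lookup (proj₂ (Equivalence.to ≤⇔ G≤H))

≤-or-⧏ : ∀ G H → G ≤ H ⊎ H ⧏ G
≤-or-⧏ G H with leB G H Bool.≟ true
... | yes G≤H = inj₁ (mk≤ G≤H)
... | no  G≰H = inj₂ (G≰H ∘ leB≡true)

game-ind : (P : Game → Set) → (∀ G → All P (leftOptions G) → All P (rightOptions G) → P G) → ∀ G → P G
game-ind P step = go
  where
  go : ∀ G → P G
  goAll : ∀ xs → All P xs
  go ⟨ gl ∣ gr ⟩ = step ⟨ gl ∣ gr ⟩ (goAll gl) (goAll gr)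
  goAll []       = []
  goAll (x ∷ xs) = go x ∷ goAll xs

≤-refl : ∀ G → G ≤ G
≤-refl = game-ind (λ G → G ≤ G) λ G ihL ihR →
  ≤-intro (All.tabulate λ x∈ G≤x → ≤⇒leftOption⧏ G≤x x∈ (All.lookup ihL x∈))
          (All.tabulate λ y∈ y≤G → ≤⇒⧏rightOption y≤G y∈ (All.lookup ihR y∈))

leftOption⧏ : ∀ {G x} → x ∈ leftOptions G → x ⧏ G
leftOption⧏ {x = x} x∈ G≤x = ≤⇒leftOption⧏ G≤x x∈ (≤-refl x)

⧏rightOption : ∀ {G y} → y ∈ rightOptions G → G ⧏ y
⧏rightOption {y = y} y∈ y≤G = ≤⇒⧏rightOption y≤G y∈ (≤-refl y)

size : Game → ℕ
sizes : List Game → ℕ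
size ⟨ gl ∣ gr ⟩ = suc (sizes gl + sizes gr)
sizes []       = 0
sizes (x ∷ xs) = size x + sizes xs

size-∈ : ∀ {x xs} → x ∈ xs → size x ℕ.≤ sizes xs
size-∈ {xs = x ∷ xs} (here refl) = m≤m+n (size x) (sizes xs)
size-∈ {xs = y ∷ xs} (there x∈) = ℕ.≤-trans (size-∈ x∈) (m≤n+m (sizes xs) (size y))

size-leftOption : ∀ {G x} → x ∈ leftOptions G → size x < size G
size-leftOption {⟨ gl ∣ gr ⟩} x∈ = s≤s (ℕ.≤-trans (size-∈ x∈) (m≤m+n (sizes gl) (sizes gr)))

size-rightOption : ∀ {G y} → y ∈ rightOptions G → size y < size G
size-rightOption {⟨ gl ∣ gr ⟩} y∈ = s≤s (ℕ.≤-trans (size-∈ y∈) (m≤n+m (sizes gr) (sizes gl)))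

private
  <-rotateˡ : ∀ {a b} c d → a < b → c + d + a < b + c + d
  <-rotateˡ {a} {b} c d a<b = begin-strict
    c + d + a   <⟨ +-monoʳ-< (c + d) a<b ⟩
    c + d + b   ≡⟨ +-comm (c + d) b ⟩
    b + (c + d) ≡⟨ sym (+-assoc b c d) ⟩
    b + c + d   ∎
    where open ℕ.≤-Reasoning

  <-rotateʳ : ∀ {a b} c d → a < b → a + c + d < c + d + b
  <-rotateʳ {a} {b} c d a<b = begin-strict
    a + c + d   ≡⟨ +-assoc a c d ⟩
    a + (c + d) ≡⟨ +-comm a (c + d) ⟩
    c + d + a   <⟨ +-monoʳ-< (c + d) a<b ⟩
    c + d + b   ∎
    where open ℕ.≤-Reasoning

≤-trans : ∀ {G H K} → G ≤ H → H ≤ K → G ≤ K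
≤-trans {G} {H} {K} = go (<-wellFounded (size G + size H + size K))
  where
  go : ∀ {G H K} → Acc _<_ (size G + size H + size K) → G ≤ H → H ≤ K → G ≤ K
  go {G} {H} {K} (acc rec) G≤H H≤K = ≤-intro
    (All.tabulate λ x∈ K≤x →
      ≤⇒leftOption⧏ G≤H x∈ (go (rec (<-rotateˡ (size H) (size K) (size-leftOption x∈))) H≤K K≤x))
    (All.tabulate λ y∈ y≤G →
      ≤⇒⧏rightOption H≤K y∈ (go (rec (<-rotateʳ (size G) (size H) (size-rightOption y∈))) y≤G G≤H))

≤-⧏-trans : ∀ {G H K} → G ≤ H → H ⧏ K → G ⧏ K
≤-⧏-trans G≤H H⧏K K≤G = H⧏K (≤-trans K≤G G≤H)

⧏-≤-trans : ∀ {G H K} → G ⧏ H → H ≤ K → G ⧏ K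
⧏-≤-trans G⧏H H≤K K≤G = G⧏H (≤-trans H≤K K≤G)

≈-refl : ∀ G → G ≈ G
≈-refl G = ≤-refl G , ≤-refl G

≈-trans : ∀ {G H K} → G ≈ H → H ≈ K → G ≈ K
≈-trans (G≤H , H≤G) (H≤K , K≤H) = ≤-trans G≤H H≤K , ≤-trans K≤H H≤G

-- Integers

natGame-mono : ∀ {m n} → m ℕ.≤ n → natGame m ≤ natGame n
natGame-mono {zero}  {zero}  _         = ≤-intro [] []
natGame-mono {zero}  {suc n} _         = ≤-intro [] []
natGame-mono {suc m} {suc n} (s≤s m≤n) =
  ≤-intro (≤-⧏-trans (natGame-mono m≤n) (leftOption⧏ (here refl)) ∷ []) []

natGame-strict : ∀ {m n} → m < n → natGame m ⧏ natGame n
natGame-strict m<n = ⧏-≤-trans (leftOption⧏ (here refl)) (natGame-mono m<n)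

negNatGame-anti : ∀ {m n} → m ℕ.≤ n → negNatGame n ≤ negNatGame m
negNatGame-anti {zero}  {zero}  _         = ≤-intro [] []
negNatGame-anti {zero}  {suc n} _         = ≤-intro [] []
negNatGame-anti {suc m} {suc n} (s≤s m≤n) =
  ≤-intro [] (⧏-≤-trans (⧏rightOption (here refl)) (negNatGame-anti m≤n) ∷ [])

negNatGame-strict : ∀ {m n} → m < n → negNatGame n ⧏ negNatGame m
negNatGame-strict {m} m<n =
  ≤-⧏-trans (negNatGame-anti {suc m} m<n) (⧏rightOption {negNatGame (suc m)} (here refl))

intGame-mono : ∀ {i j} → i ℤ.≤ j → intGame i ≤ intGame j
intGame-mono (-≤+ {m}) = ≤-trans (negNatGame-anti {0} {suc m} z≤n) (natGame-mono z≤n)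
intGame-mono (-≤- n≤m) = negNatGame-anti (s≤s n≤m)
intGame-mono (+≤+ m≤n) = natGame-mono m≤n

intGame-⧏-suc : ∀ i → intGame i ⧏ intGame (ℤ.suc i)
intGame-⧏-suc (+ n)        = leftOption⧏ (here refl)
intGame-⧏-suc -[1+ zero ]  = ⧏rightOption (here refl)
intGame-⧏-suc -[1+ suc n ] = ⧏rightOption (here refl)

leftOption-intGame : ∀ {i x} → x ∈ leftOptions (intGame i) → x ≡ intGame (ℤ.pred i)
leftOption-intGame {+ suc n} (here refl) = refl
leftOption-intGame {+ zero}  ()
leftOption-intGame { -[1+ n ]} ()

rightOption-intGame : ∀ {i y} → y ∈ rightOptions (intGame i) → y ≡ intGame (ℤ.suc i)
rightOption-intGame { -[1+ zero ]}  (here refl) = refl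
rightOption-intGame { -[1+ suc n ]} (here refl) = refl
rightOption-intGame {+ zero}  ()
rightOption-intGame {+ suc n} ()

intGame≈switch : ∀ i → intGame i ≈ switchGame (ℤ.pred i) (ℤ.suc i)
intGame≈switch i =
  ≤-intro (All.tabulate λ x∈ → subst (_⧏ S) (sym (leftOption-intGame {i} x∈)) (leftOption⧏ (here refl)))
          (intGame-⧏-suc i ∷ []) ,
  ≤-intro (subst (λ j → intGame (ℤ.pred i) ⧏ intGame j) (suc-pred i) (intGame-⧏-suc (ℤ.pred i)) ∷ [])
          (All.tabulate λ y∈ → subst (S ⧏_) (sym (rightOption-intGame {i} y∈)) (⧏rightOption (here refl)))
  where
  S : Game
  S = switchGame (ℤ.pred i) (ℤ.suc i)

IsInteger : Game → Set
IsInteger G = Σ ℤ λ i → G ≈ intGame i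

-- Games equal to integers

record Fits (G : Game) (i : ℤ) : Set where
  constructor _,_
  field
    leftOptions⧏ : All (_⧏ intGame i) (leftOptions G)
    ⧏rightOptions : All (intGame i ⧏_) (rightOptions G)

Misfit : Game → ℤ → Set
Misfit G i = Any (intGame i ≤_) (leftOptions G) ⊎ Any (_≤ intGame i) (rightOptions G)

private
  All⊎Any : ∀ {A : Set} {P Q : A → Set} → (∀ x → P x ⊎ Q x) → ∀ xs → All P xs ⊎ Any Q xs
  All⊎Any P⊎Q []       = inj₁ []
  All⊎Any P⊎Q (x ∷ xs) with P⊎Q x | All⊎Any P⊎Q xs
  ... | inj₂ q | _       = inj₂ (here q)
  ... | inj₁ p | inj₁ ps = inj₁ (p ∷ ps)
  ... | inj₁ p | inj₂ qs = inj₂ (there qs)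

fits-or-misfit : ∀ G i → Fits G i ⊎ Misfit G i
fits-or-misfit G i
  with All⊎Any (λ L → swap (≤-or-⧏ (intGame i) L)) (leftOptions G)
     | All⊎Any (λ R → swap (≤-or-⧏ R (intGame i))) (rightOptions G)
... | inj₁ ls | inj₁ rs = inj₁ (ls , rs)
... | inj₂ l  | _       = inj₂ (inj₁ l)
... | inj₁ _  | inj₂ r  = inj₂ (inj₂ r)

misfit-below⇒⧏ : ∀ {G i} j → Fits G i → intGame j ≤ intGame i → Misfit G j → intGame j ⧏ G
misfit-below⇒⧏ _ _ _ (inj₁ l) with find l
... | L , L∈ , j≤L = ≤-⧏-trans j≤L (leftOption⧏ L∈)
misfit-below⇒⧏ _ (_ , rs) j≤i (inj₂ r) with find r
... | R , R∈ , R≤j = ⊥-elim (All.lookup rs R∈ (≤-trans R≤j j≤i))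

misfit-above⇒⧏ : ∀ {G i} j → Fits G i → intGame i ≤ intGame j → Misfit G j → G ⧏ intGame j
misfit-above⇒⧏ _ (ls , _) i≤j (inj₁ l) with find l
... | L , L∈ , j≤L = ⊥-elim (All.lookup ls L∈ (≤-trans i≤j j≤L))
misfit-above⇒⧏ _ _ _ (inj₂ r) with find r
... | R , R∈ , R≤j = ⧏-≤-trans (⧏rightOption R∈) R≤j

fits⇒≈ : ∀ {G i} → Fits G i →
  All (_⧏ G) (leftOptions (intGame i)) → All (G ⧏_) (rightOptions (intGame i)) → G ≈ intGame i
fits⇒≈ (ls , rs) ls′ rs′ = ≤-intro ls rs′ , ≤-intro ls′ rs

fits-nonneg⇒integer : ∀ {G} n → Fits G (+ n) → IsInteger G
fits-nonneg⇒integer zero    fits = + 0 , fits⇒≈ fits [] []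
fits-nonneg⇒integer {G} (suc n) fits with fits-or-misfit G (+ n)
... | inj₁ fits′  = fits-nonneg⇒integer n fits′
... | inj₂ misfit =
  + suc n , fits⇒≈ fits (misfit-below⇒⧏ (+ n) fits (natGame-mono (n≤1+n n)) misfit ∷ []) []

fits-neg⇒integer : ∀ {G} n → Fits G -[1+ n ] → IsInteger G
fits-neg⇒integer {G} zero fits with fits-or-misfit G (+ 0)
... | inj₁ fits′  = fits-nonneg⇒integer 0 fits′
... | inj₂ misfit =
  -[1+ 0 ] , fits⇒≈ fits [] (misfit-above⇒⧏ (+ 0) fits (intGame-mono (-≤+ {0} {0})) misfit ∷ [])
fits-neg⇒integer {G} (suc n) fits with fits-or-misfit G -[1+ n ]
... | inj₁ fits′  = fits-neg⇒integer n fits′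
... | inj₂ misfit =
  -[1+ suc n ] , fits⇒≈ fits [] (misfit-above⇒⧏ -[1+ n ] fits (negNatGame-anti (n≤1+n (suc n))) misfit ∷ [])

fits⇒integer : ∀ {G i} → Fits G i → IsInteger G
fits⇒integer {i = + n}      = fits-nonneg⇒integer n
fits⇒integer {i = -[1+ n ]} = fits-neg⇒integer n

≤natGame-size : ∀ G → G ≤ natGame (size G)
≤natGame-size = game-ind _ λ { G@(⟨ _ ∣ _ ⟩) ih _ →
  ≤-intro (All.tabulate λ x∈ → ≤-⧏-trans (All.lookup ih x∈) (natGame-strict (size-leftOption {G} x∈))) [] }

negNatGame-size≤ : ∀ G → negNatGame (size G) ≤ G
negNatGame-size≤ = game-ind _ λ { G@(⟨ _ ∣ _ ⟩) _ ih →
  ≤-intro [] (All.tabulate λ y∈ → ⧏-≤-trans (negNatGame-strict (size-rightOption {G} y∈)) (All.lookup ih y∈)) }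

leftSided-integer : ∀ gl → IsInteger ⟨ gl ∣ [] ⟩
leftSided-integer gl =
  fits⇒integer {i = + size ⟨ gl ∣ [] ⟩} (proj₁ (Equivalence.to ≤⇔ (≤natGame-size ⟨ gl ∣ [] ⟩)) , [])

rightSided-integer : ∀ gr → IsInteger ⟨ [] ∣ gr ⟩
rightSided-integer gr =
  fits⇒integer {i = -[1+ sizes gr ]} ([] , proj₂ (Equivalence.to ≤⇔ (negNatGame-size≤ ⟨ [] ∣ gr ⟩)))

integer⇒switch : ∀ {G} → IsInteger G → ∃ λ m → ∃ λ k → G ≈ switchGame m k
integer⇒switch (i , G≈i) = ℤ.pred i , ℤ.suc i , ≈-trans G≈i (intGame≈switch i)

module _ (O : TotalPreorder 0ℓ 0ℓ 0ℓ) {A : Set} (P : A → TotalPreorder.Carrier O → Set) where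
  open TotalPreorder O using (_≲_; total) renaming (refl to ≲-refl; trans to ≲-trans)

  greatest : ∀ {a xs} → a ∈ xs → All (λ x → ∃ (P x)) xs →
    ∃ λ b → Any (λ x → P x b) xs × All (λ x → ∃ λ c → P x c × c ≲ b) xs
  greatest {xs = x ∷ []}     _ ((c , p) ∷ []) = c , here p , (c , p , ≲-refl) ∷ []
  greatest {xs = x ∷ _ ∷ _} _ ((c , p) ∷ ps) with greatest (here refl) ps
  ... | b , attained , bounded with total c b
  ...   | inj₁ c≲b = b , there attained , (c , p , c≲b) ∷ bounded
  ...   | inj₂ b≲c =
    c , here p , (c , p , ≲-refl) ∷ All.map (λ (d , q , d≲b) → d , q , ≲-trans d≲b b≲c) bounded

≤intGame : ∀ {G i} → (∃ λ j → G ≈ intGame j × j ℤ.≤ i) → G ≤ intGame i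
≤intGame (j , G≈j , j≤i) = ≤-trans (proj₁ G≈j) (intGame-mono j≤i)

intGame≤ : ∀ {G i} → (∃ λ j → G ≈ intGame j × i ℤ.≤ j) → intGame i ≤ G
intGame≤ (j , G≈j , i≤j) = ≤-trans (intGame-mono i≤j) (proj₂ G≈j)

GreatestValue LeastValue : List Game → ℤ → Set
GreatestValue xs i = Any (intGame i ≤_) xs × All (_≤ intGame i) xs
LeastValue    xs i = Any (_≤ intGame i) xs × All (intGame i ≤_) xs

greatestInteger : ∀ {x xs} → x ∈ xs → All IsInteger xs → ∃ (GreatestValue xs)
greatestInteger x∈ integers with greatest ≤-totalPreorder (λ x i → x ≈ intGame i) x∈ integers
... | i , attained , upper = i , Any.map proj₂ attained , All.map ≤intGame upper

leastInteger : ∀ {x xs} → x ∈ xs → All IsInteger xs → ∃ (LeastValue xs)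
leastInteger x∈ integers
  with greatest (Flip.totalPreorder ≤-totalPreorder) (λ x i → x ≈ intGame i) x∈ integers
... | i , attained , lower = i , Any.map proj₁ attained , All.map intGame≤ lower

integerOptions⇒switch : ∀ G → All IsInteger (leftOptions G) → All IsInteger (rightOptions G) →
  ∃ λ m → ∃ λ k → G ≈ switchGame m k
integerOptions⇒switch ⟨ gl ∣ [] ⟩         _ _ = integer⇒switch (leftSided-integer gl)
integerOptions⇒switch ⟨ [] ∣ gr@(_ ∷ _) ⟩ _ _ = integer⇒switch (rightSided-integer gr)
integerOptions⇒switch ⟨ _ ∷ _ ∣ _ ∷ _ ⟩ lefts rights
  with greatestInteger (here refl) lefts | leastInteger (here refl) rights
... | a , a≤someLeft , lefts≤a | b , someRight≤b , b≤rights with find a≤someLeft | find someRight≤b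
...   | _ , L*∈ , a≤L* | _ , R*∈ , R*≤b = a , b ,
  ≤-intro (All.map (λ L≤a → ≤-⧏-trans L≤a (leftOption⧏ (here refl))) lefts≤a)
          (⧏-≤-trans (⧏rightOption R*∈) R*≤b ∷ []) ,
  ≤-intro (≤-⧏-trans a≤L* (leftOption⧏ L*∈) ∷ [])
          (All.map (⧏-≤-trans (⧏rightOption (here refl))) b≤rights)

Commuting : Game → Set
Commuting G = ∀ {L R} → L ∈ leftOptions G → R ∈ rightOptions G →
  ∃ λ Q → Q ∈ rightOptions L × Q ∈ leftOptions R

commuting⇒integer : ∀ G → Commuting G →
  (∀ {L Q} → L ∈ leftOptions G → Q ∈ rightOptions L → IsInteger Q) → IsInteger G
commuting⇒integer ⟨ gl ∣ [] ⟩         _ _ = leftSided-integer gl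
commuting⇒integer ⟨ [] ∣ gr@(_ ∷ _) ⟩ _ _ = rightSided-integer gr
commuting⇒integer G@(⟨ _ ∷ _ ∣ _ ∷ _ ⟩) commute integral
  with greatest ≤-totalPreorder (LeastValue ∘ rightOptions) (here refl) (All.tabulate leastRight)
  where
  leastRight : ∀ {L} → L ∈ leftOptions G → ∃ (LeastValue (rightOptions L))
  leastRight L∈ = leastInteger (proj₁ (proj₂ (commute L∈ (here refl)))) (All.tabulate (integral L∈))
... | i , i-attained , i-upper with find i-attained
...   | _ , L*∈ , _ , i≤rightOptionsL* =
  fits⇒integer {i = i} (All.map leftOption⧏i i-upper , All.tabulate i⧏rightOption)
  where
  leftOption⧏i : ∀ {L} → (∃ λ j → LeastValue (rightOptions L) j × j ℤ.≤ i) → L ⧏ intGame i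
  leftOption⧏i (j , (someRight≤j , _) , j≤i) with find someRight≤j
  ... | Q , Q∈ , Q≤j = ⧏-≤-trans (⧏rightOption Q∈) (≤-trans Q≤j (intGame-mono j≤i))

  i⧏rightOption : ∀ {R} → R ∈ rightOptions G → intGame i ⧏ R
  i⧏rightOption R∈ with commute L*∈ R∈
  ... | Q , Q∈rightL* , Q∈leftR = ≤-⧏-trans (All.lookup i≤rightOptionsL* Q∈rightL*) (leftOption⧏ Q∈leftR)

-- Yashima positions

concatMap-unique : ∀ {A B : Set} (f : A → List B) (φ : List A → List B) →
  φ [] ≡ [] → (∀ x xs → φ (x ∷ xs) ≡ f x ++ φ xs) → ∀ xs → φ xs ≡ concatMap f xs
concatMap-unique f φ φ[] φ∷ []       = φ[]
concatMap-unique f φ φ[] φ∷ (x ∷ xs) = trans (φ∷ x xs) (cong (f x ++_) (concatMap-unique f φ φ[] φ∷ xs))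

leftMoves rightMoves : ∀ {V n} → Vec (Edge V) (suc n) → Fin V → Fin V → Fin (suc n) → List Game
leftMoves  E l r i = map (λ v → yashima (removeAt E i) v r) (targets l r (lookup E i))
rightMoves E l r i = map (λ w → yashima (removeAt E i) l w) (targets r l (lookup E i))

-- The `_` is the private concatMap of Defs, found by unification once `with` has
-- abstracted the list of edge indices.
leftOptions-yashima : ∀ {V n} (E : Vec (Edge V) (suc n)) l r →
  leftOptions (yashima E l r) ≡ concatMap (leftMoves E l r) (toList (allFin (suc n)))
leftOptions-yashima {n = n} E l r
  with toList (tabulate {n = n} fsuc) | concatMap-unique (leftMoves E l r) _ refl (λ _ _ → refl)
... | is | φ≡concatMap = cong (leftMoves E l r fzero ++_) (φ≡concatMap is)

rightOptions-yashima : ∀ {V n} (E : Vec (Edge V) (suc n)) l r →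
  rightOptions (yashima E l r) ≡ concatMap (rightMoves E l r) (toList (allFin (suc n)))
rightOptions-yashima {n = n} E l r
  with toList (tabulate {n = n} fsuc) | concatMap-unique (rightMoves E l r) _ refl (λ _ _ → refl)
... | is | φ≡concatMap = cong (rightMoves E l r fzero ++_) (φ≡concatMap is)

module _ {A B C : Set} (f : A → B → C) (g : A → List B) where

  ∈-concatMap-map⁻ : ∀ {xs z} → z ∈ concatMap (λ a → map (f a) (g a)) xs →
    ∃ λ a → ∃ λ b → b ∈ g a × z ≡ f a b
  ∈-concatMap-map⁻ {xs} z∈ with find (Any.concatMap⁻ (λ a → map (f a) (g a)) {xs = xs} z∈)
  ... | a , _ , z∈map = a , ∈-map⁻ (f a) z∈map

  ∈-concatMap-map⁺ : ∀ {xs a b} → a ∈ xs → b ∈ g a → f a b ∈ concatMap (λ a → map (f a) (g a)) xs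
  ∈-concatMap-map⁺ a∈ b∈ = Any.concatMap⁺ (λ a → map (f a) (g a)) (lose a∈ (∈-map⁺ (f _) b∈))

data LeftSlide {V} : ∀ {n} → Vec (Edge V) n → Fin V → Fin V → Game → Set where
  leftSlide : ∀ {n} {E : Vec (Edge V) (suc n)} {l r v} i → v ∈ targets l r (lookup E i) →
              LeftSlide E l r (yashima (removeAt E i) v r)

data RightSlide {V} : ∀ {n} → Vec (Edge V) n → Fin V → Fin V → Game → Set where
  rightSlide : ∀ {n} {E : Vec (Edge V) (suc n)} {l r w} i → w ∈ targets r l (lookup E i) →
               RightSlide E l r (yashima (removeAt E i) l w)

∈-leftOptions⁻ : ∀ {V n} (E : Vec (Edge V) n) l r {G} →
  G ∈ leftOptions (yashima E l r) → LeftSlide E l r G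
∈-leftOptions⁻ {n = zero} _ _ _ ()
∈-leftOptions⁻ {n = suc n} E l r G∈
  with ∈-concatMap-map⁻ (λ i v → yashima (removeAt E i) v r) (λ i → targets l r (lookup E i))
         {toList (allFin _)} (subst (_ ∈_) (leftOptions-yashima E l r) G∈)
... | i , v , v∈ , refl = leftSlide i v∈

∈-leftOptions⁺ : ∀ {V n} {E : Vec (Edge V) n} {l r G} →
  LeftSlide E l r G → G ∈ leftOptions (yashima E l r)
∈-leftOptions⁺ {l = l} {r} (leftSlide {E = E} i v∈) =
  subst (_ ∈_) (sym (leftOptions-yashima E l r)) (∈-concatMap-map⁺ _ _ (∈-toList⁺ (∈-allFin⁺ i)) v∈)

∈-rightOptions⁻ : ∀ {V n} (E : Vec (Edge V) n) l r {G} →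
  G ∈ rightOptions (yashima E l r) → RightSlide E l r G
∈-rightOptions⁻ {n = zero} _ _ _ ()
∈-rightOptions⁻ {n = suc n} E l r G∈
  with ∈-concatMap-map⁻ (λ i w → yashima (removeAt E i) l w) (λ i → targets r l (lookup E i))
         {toList (allFin _)} (subst (_ ∈_) (rightOptions-yashima E l r) G∈)
... | i , w , w∈ , refl = rightSlide i w∈

∈-rightOptions⁺ : ∀ {V n} {E : Vec (Edge V) n} {l r G} →
  RightSlide E l r G → G ∈ rightOptions (yashima E l r)
∈-rightOptions⁺ {l = l} {r} (rightSlide {E = E} i w∈) =
  subst (_ ∈_) (sym (rightOptions-yashima E l r)) (∈-concatMap-map⁺ _ _ (∈-toList⁺ (∈-allFin⁺ i)) w∈)

Joins : ∀ {V} → Edge V → Fin V → Fin V → Set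
Joins e u v = e ≡ (u , v) ⊎ e ≡ (v , u)

∈-targets⁻ : ∀ {V} {u o v : Fin V} e → v ∈ targets u o e → Joins e u v × v ≢ o
∈-targets⁻ {u = u} {o} (a , b) v∈ with a ≟ u | b ≟ o | b ≟ u | a ≟ o | v∈
... | yes refl | no b≢o | _        | _      | here refl         = inj₁ refl , b≢o
... | yes refl | no _   | yes refl | no a≢o | there (here refl) = inj₂ refl , a≢o
... | yes _    | yes _  | yes refl | no a≢o | here refl         = inj₂ refl , a≢o
... | no _     | _      | yes refl | no a≢o | here refl         = inj₂ refl , a≢o

∈-targets⁺ : ∀ {V} {u o v : Fin V} e → Joins e u v → v ≢ o → v ∈ targets u o e
∈-targets⁺ {u = u} {o} {v} _ (inj₁ refl) v≢o with u ≟ u | v ≟ o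
... | yes _  | no _    = here refl
... | yes _  | yes v≡o = contradiction v≡o v≢o
... | no u≢u | _       = contradiction refl u≢u
∈-targets⁺ {u = u} {o} {v} _ (inj₂ refl) v≢o with u ≟ u | v ≟ o
... | yes _  | no _    = ∈-++⁺ʳ _ (here refl)
... | yes _  | yes v≡o = contradiction v≡o v≢o
... | no u≢u | _       = contradiction refl u≢u

retarget : ∀ {V} {u o o′ v : Fin V} e → v ∈ targets u o e → v ≢ o′ → v ∈ targets u o′ e
retarget e v∈ v≢o′ = ∈-targets⁺ e (proj₁ (∈-targets⁻ e v∈)) v≢o′

targets-disjoint : ∀ {V} {l r v w : Fin V} e → l ≢ r → v ∈ targets l r e → w ∈ targets r l e → ⊥
targets-disjoint e l≢r v∈ w∈ with ∈-targets⁻ e v∈ | ∈-targets⁻ e w∈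
... | inj₁ refl , _   | inj₁ eq , _   = l≢r (cong proj₁ eq)
... | inj₁ refl , v≢r | inj₂ eq , _   = v≢r (cong proj₂ eq)
... | inj₂ refl , v≢r | inj₁ eq , _   = v≢r (cong proj₁ eq)
... | inj₂ refl , _   | inj₂ eq , _   = l≢r (cong proj₂ eq)

lookup-removeAt : ∀ {A : Set} {n} (xs : Vec A (suc n)) i j → lookup (removeAt xs i) j ≡ lookup xs (punchIn i j)
lookup-removeAt xs i j =
  trans (cong (lookup (removeAt xs i)) (sym (punchOut-punchIn i))) (removeAt-punchOut xs (punchInᵢ≢i i j ∘ sym))

removeAt-proper : ∀ {V n} (E : Vec (Edge V) (suc n)) (c : Fin V → Bool) i →
  ProperColouring E c → ProperColouring (removeAt E i) c
removeAt-proper E c i proper j rewrite lookup-removeAt E i j = proper (punchIn i j)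

slide-changesColour : ∀ {V n} (E : Vec (Edge V) n) (c : Fin V → Bool) → ProperColouring E c →
  ∀ i {u o v} → v ∈ targets u o (lookup E i) → c v ≢ c u
slide-changesColour E c proper i v∈ with ∈-targets⁻ (lookup E i) v∈
... | inj₁ eq , _ = λ cv≡cu → proper i (subst (λ e → c (proj₁ e) ≡ c (proj₂ e)) (sym eq) (sym cv≡cu))
... | inj₂ eq , _ = λ cv≡cu → proper i (subst (λ e → c (proj₁ e) ≡ c (proj₂ e)) (sym eq) cv≡cu)

removeAt-removeAt : ∀ {A : Set} {n} (xs : Vec A (suc (suc n))) {i j} (i≢j : i ≢ j) (j≢i : j ≢ i) →
  removeAt (removeAt xs i) (punchOut i≢j) ≡ removeAt (removeAt xs j) (punchOut j≢i)
removeAt-removeAt (x ∷ xs)     {fzero}  {fzero}  i≢j _ = contradiction refl i≢j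
removeAt-removeAt (x ∷ y ∷ xs) {fzero}  {fsuc j} _ _ = refl
removeAt-removeAt (x ∷ y ∷ xs) {fsuc i} {fzero}  _ _ = refl
removeAt-removeAt {n = zero}  (x ∷ y ∷ xs) {fsuc fzero} {fsuc fzero} i≢j _ = contradiction refl i≢j
removeAt-removeAt {A} {suc n} (x ∷ y ∷ xs) {fsuc i} {fsuc j} i≢j j≢i = begin
  removeAt (x ∷ removeAt (y ∷ xs) i) (fsuc i′) ≡⟨ removeAt-suc (removeAt (y ∷ xs) i) i′ ⟩
  x ∷ removeAt (removeAt (y ∷ xs) i) i′        ≡⟨ cong (x ∷_) (removeAt-removeAt (y ∷ xs) i≢j′ j≢i′) ⟩
  x ∷ removeAt (removeAt (y ∷ xs) j) j′        ≡⟨ removeAt-suc (removeAt (y ∷ xs) j) j′ ⟨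
  removeAt (x ∷ removeAt (y ∷ xs) j) (fsuc j′) ∎
  where
  open ≡-Reasoning
  i≢j′ : i ≢ j
  i≢j′ = i≢j ∘ cong fsuc
  j≢i′ : j ≢ i
  j≢i′ = j≢i ∘ cong fsuc
  i′ j′ : Fin (suc n)
  i′ = punchOut i≢j′
  j′ = punchOut j≢i′
  removeAt-suc : ∀ {m} (ys : Vec A (suc m)) k → removeAt (x ∷ ys) (fsuc k) ≡ x ∷ removeAt ys k
  removeAt-suc (_ ∷ _) _ = refl

slides-commute : ∀ {V n} (E : Vec (Edge V) (suc n)) {l r v w} i j → l ≢ r → v ≢ w →
  v ∈ targets l r (lookup E i) → w ∈ targets r l (lookup E j) →
  ∃ λ Q → Q ∈ rightOptions (yashima (removeAt E i) v r) × Q ∈ leftOptions (yashima (removeAt E j) l w)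
slides-commute {n = zero} E fzero fzero l≢r _ v∈ w∈ = ⊥-elim (targets-disjoint (lookup E fzero) l≢r v∈ w∈)
slides-commute {n = suc n} E {l} {r} {v} {w} i j l≢r v≢w v∈ w∈ =
  yashima (removeAt (removeAt E i) (punchOut i≢j)) v w ,
  ∈-rightOptions⁺ (rightSlide {E = removeAt E i} (punchOut i≢j) w∈′) ,
  subst (λ E′ → yashima E′ v w ∈ leftOptions (yashima (removeAt E j) l w)) (removeAt-removeAt E j≢i i≢j)
        (∈-leftOptions⁺ (leftSlide {E = removeAt E j} (punchOut j≢i) v∈′))
  where
  i≢j : i ≢ j
  i≢j refl = targets-disjoint (lookup E i) l≢r v∈ w∈
  j≢i : j ≢ i
  j≢i = i≢j ∘ sym
  w∈′ : w ∈ targets r v (lookup (removeAt E i) (punchOut i≢j))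
  w∈′ = subst ((w ∈_) ∘ targets r v) (sym (removeAt-punchOut E i≢j)) (retarget (lookup E j) w∈ (v≢w ∘ sym))
  v∈′ : v ∈ targets l w (lookup (removeAt E j) (punchOut j≢i))
  v∈′ = subst ((v ∈_) ∘ targets l w) (sym (removeAt-punchOut E j≢i)) (retarget (lookup E i) v∈ v≢w)

≢∧≢⇒≡ : ∀ {a b c : Bool} → a ≢ b → c ≢ b → a ≡ c
≢∧≢⇒≡ a≢b c≢b = trans (¬-not a≢b) (sym (¬-not c≢b))

differentColour⇒integer : ∀ {V n} (E : Vec (Edge V) n) {l r} → l ≢ r → DifferentColour E l r →
  IsInteger (yashima E l r)
differentColour⇒integer {n = zero} _ _ _ = + 0 , ≈-refl _
differentColour⇒integer {V} {suc n} E {l} {r} l≢r (c , proper , cl≢cr) = commuting⇒integer _ commute integral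
  where
  cv≡cr : ∀ {i v} → v ∈ targets l r (lookup E i) → c v ≡ c r
  cv≡cr {i} v∈ = ≢∧≢⇒≡ (slide-changesColour E c proper i v∈) (cl≢cr ∘ sym)

  commute : Commuting (yashima E l r)
  commute L∈ R∈ with ∈-leftOptions⁻ E l r L∈ | ∈-rightOptions⁻ E l r R∈
  ... | leftSlide {v = v} i v∈ | rightSlide {w = w} j w∈ = slides-commute E i j l≢r v≢w v∈ w∈
    where
    v≢w : v ≢ w
    v≢w refl = slide-changesColour E c proper j w∈ (cv≡cr v∈)

  integral : ∀ {L Q} → L ∈ leftOptions (yashima E l r) → Q ∈ rightOptions L → IsInteger Q
  integral L∈ Q∈ with ∈-leftOptions⁻ E l r L∈
  ... | leftSlide {v = v} i v∈ with ∈-rightOptions⁻ (removeAt E i) v r Q∈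
  ...   | rightSlide j w∈ =
    differentColour⇒integer (removeAt E′ j) (proj₂ (∈-targets⁻ (lookup E′ j) w∈) ∘ sym)
      (c , removeAt-proper E′ c j proper′ ,
       λ cv≡cw → slide-changesColour E′ c proper′ j w∈ (trans (sym cv≡cw) (cv≡cr v∈)))
    where
    E′ : Vec (Edge V) n
    E′ = removeAt E i
    proper′ : ProperColouring E′ c
    proper′ = removeAt-proper E c i proper

sameColour⇒integerOptions : ∀ {V n} (E : Vec (Edge V) n) {l r} (c : Fin V → Bool) → ProperColouring E c →
  c l ≡ c r → All IsInteger (leftOptions (yashima E l r)) × All IsInteger (rightOptions (yashima E l r))
sameColour⇒integerOptions E {l} {r} c proper cl≡cr = All.tabulate leftInteger , All.tabulate rightInteger
  where
  leftInteger : ∀ {L} → L ∈ leftOptions (yashima E l r) → IsInteger L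
  leftInteger L∈ with ∈-leftOptions⁻ E l r L∈
  ... | leftSlide i v∈ =
    differentColour⇒integer (removeAt E i) (proj₂ (∈-targets⁻ (lookup E i) v∈))
      (c , removeAt-proper E c i proper , λ cv≡cr → slide-changesColour E c proper i v∈ (trans cv≡cr (sym cl≡cr)))

  rightInteger : ∀ {R} → R ∈ rightOptions (yashima E l r) → IsInteger R
  rightInteger R∈ with ∈-rightOptions⁻ E l r R∈
  ... | rightSlide j w∈ =
    differentColour⇒integer (removeAt E j) (proj₂ (∈-targets⁻ (lookup E j) w∈) ∘ sym)
      (c , removeAt-proper E c j proper , λ cl≡cw → slide-changesColour E c proper j w∈ (trans (sym cl≡cw) cl≡cr))

≈⇒≈G : ∀ {G H} → G ≈ H → G ≈G H
≈⇒≈G (G≤H , H≤G) = leB≡true G≤H , leB≡true H≤G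

corollary5 : ∀ {V n} (E : Vec (Edge V) n) (l r : Fin V) → l ≢ r → Bipartite E →
    (Σ ℤ λ m → Σ ℤ λ k → yashima E l r ≈G switchGame m k)
    × (DifferentColour E l r → Σ ℤ λ m → yashima E l r ≈G intGame m)
corollary5 E l r l≢r (c , proper) = map₂ (map₂ ≈⇒≈G) switch , map₂ ≈⇒≈G ∘ differentColour⇒integer E l≢r
  where
  switch : ∃ λ m → ∃ λ k → yashima E l r ≈ switchGame m k
  switch with c l Bool.≟ c r
  ... | no  cl≢cr = integer⇒switch (differentColour⇒integer E l≢r (c , proper , cl≢cr))
  ... | yes cl≡cr = uncurry (integerOptions⇒switch _) (sameColour⇒integerOptions E c proper cl≡cr)
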